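{- Let $q$ be an odd prime power. If $q\equiv1\pmod4$: for $c\in\{0\}\cup C_{0,0}^q\cup C_{1,1}^q$, $M_1(x^{\frac{q+1}{2}},c)=q$; for $c\in C_{0,1}^q\cup C_{1,0}^q$, $M_0(x^{\frac{q+1}{2}},c)=\frac{q-1}{2}$, $M_1(x^{\frac{q+1}{2}},c)=1$, $M_2(x^{\frac{q+1}{2}},c)=\frac{q-1}{2}$; for $c=\pm1$, $M_0(x^{\frac{q+1}{2}},c)=\frac{q-1}{2}$, $M_1(x^{\frac{q+1}{2}},c)=\frac{q-1}{2}$, $M_{\frac{q+1}{2}}(x^{\frac{q+1}{2}},c)=1$. If $q\equiv3\pmod4$: for $c\in C_{0,1}^q\cup C_{1,0}^q$, $M_1(x^{\frac{q+1}{2}},c)=q$; for $c\in\{0\}\cup C_{0,0}^q\cup C_{1,1}^q$, $M_0(x^{\frac{q+1}{2}},c)=\frac{q-1}{2}$, $M_1(x^{\frac{q+1}{2}},c)=1$, $M_2(x^{\frac{q+1}{2}},c)=\frac{q-1}{2}$; for $c=\pm1$, $M_0(x^{\frac{q+1}{2}},c)=\frac{q-1}{2}$, $M_1(x^{\frac{q+1}{2}},c)=\frac{q-1}{2}$, $M_{\frac{q+1}{2}}(x^{\frac{q+1}{2}},c)=1$. In each case all $M_j$ not listed are $0$.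
   Context: For a polynomial $f$ over $\mathbb{F}_q$ and $c\in\mathbb{F}_q$, $M_j(f,c)$ is the number of elements of $\mathbb{F}_q$ occurring exactly $j$ times in the multiset $\{f(x)-cx\mid x\in\mathbb{F}_q\}$. $C_0^{(2,q)}$ is the set of nonzero squares and $C_1^{(2,q)}$ the set of nonsquares of $\mathbb{F}_q$; for $i,j\in\{0,1\}$, $C_{i,j}^q=\{x\in\mathbb{F}_q^*\mid 1-x\in C_i^{(2,q)},\ 1+x\in C_j^{(2,q)}\}$. -}

module Defs where

open import Level using (0ℓ)
open import Data.Nat using (ℕ; zero; suc; _≥_; _^_)
open import Data.Nat.Primality using (Prime)
open import Data.Product using (Σ; ∃; _×_)
open import Data.Sum using (_⊎_)
open import Data.List using (List; length; filter)
open import Data.List.Membership.Propositional using (_∈_)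
open import Data.List.Relation.Unary.Unique.Propositional using (Unique)
open import Relation.Nullary using (¬_)
open import Relation.Binary.PropositionalEquality using (_≡_; _≢_)
open import Relation.Binary.Definitions using (DecidableEquality)
open import Algebra.Structures using (IsCommutativeRing)
import Data.Nat as ℕ

record FiniteField : Set₁ where
  infixl 6 _+_ _-_
  infixl 7 _*_
  field
    Carrier  : Set
    _+_ _*_  : Carrier → Carrier → Carrier
    -_       : Carrier → Carrier
    0# 1#    : Carrier
    isCommutativeRing : IsCommutativeRing _≡_ _+_ _*_ -_ 0# 1#
    0≢1      : 0# ≢ 1#
    inverse  : ∀ x → x ≢ 0# → ∃ λ y → x * y ≡ 1#
    _≟_      : DecidableEquality Carrier
    elements : List Carrier
    complete : ∀ x → x ∈ elements
    unique   : Unique elements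

  _-_ : Carrier → Carrier → Carrier
  x - y = x + (- y)

  size : ℕ
  size = length elements

  pow : Carrier → ℕ → Carrier
  pow x zero    = 1#
  pow x (suc n) = x * pow x n

  IsSquare : Carrier → Set
  IsSquare x = ∃ λ y → y * y ≡ x

  C0 : Carrier → Set
  C0 x = x ≢ 0# × IsSquare x

  C1 : Carrier → Set
  C1 x = x ≢ 0# × ¬ IsSquare x

  C00 C01 C10 C11 : Carrier → Set
  C00 x = x ≢ 0# × C0 (1# - x) × C0 (1# + x)
  C01 x = x ≢ 0# × C0 (1# - x) × C1 (1# + x)
  C10 x = x ≢ 0# × C1 (1# - x) × C0 (1# + x)
  C11 x = x ≢ 0# × C1 (1# - x) × C1 (1# + x)

  multiplicity : (Carrier → Carrier) → Carrier → Carrier → ℕ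
  multiplicity f c b = length (filter (λ x → (f x - c * x) ≟ b) elements)

  M : ℕ → (Carrier → Carrier) → Carrier → ℕ
  M j f c = length (filter (λ b → multiplicity f c b ℕ.≟ j) elements)

IsPrimePower : ℕ → Set
IsPrimePower q = Σ ℕ λ p → Σ ℕ λ k → Prime p × k ≥ 1 × q ≡ p ^ k

module Submission where

-- With χ(x) = x^H we have x^((q+1)/2) = x χ(x), and Euler's criterion says
-- χ(x) = 1 on the nonzero squares and χ(x) = -1 on the nonsquares.  Hence
-- f(x) - c x vanishes at 0, is (1 - c) x on the H nonzero squares and
-- -(1 + c) x on the H nonsquares, and its value distribution follows by
-- solving linear equations inside each class.

open import Defs
open import Level using (0ℓ)
open import Function using (_∘_)
open import Data.Bool using (Bool; true; false; not; _∧_; _∨_; _xor_; if_then_else_)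
open import Data.Bool.Properties using (∧-zeroʳ; ∧-identityʳ; ∧-comm; not-involutive)
open import Data.Nat as ℕ using (ℕ; zero; suc; _∸_; _/_; _%_)
import Data.Nat.Properties as ℕP
open import Data.Nat.Induction using (<-wellFounded)
open import Data.Product using (Σ; _×_; _,_; proj₁; proj₂)
open import Data.Sum using (_⊎_; inj₁; inj₂)
open import Data.Empty using (⊥-elim)
open import Data.List using (List; []; _∷_; length; filter)
open import Data.List.Properties using (filter-accept; filter-reject; filter-all)
open import Data.List.Membership.Propositional using (_∈_; lose)
open import Data.List.Membership.Propositional.Properties using (∈-filter⁺; ∈-filter⁻)
open import Data.List.Relation.Unary.Any using (here; there; any?; satisfied)
open import Data.List.Relation.Unary.All as All using (All; []; _∷_)
import Data.List.Relation.Unary.AllPairs as AllPairs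
open import Data.List.Relation.Unary.Unique.Propositional using (Unique; []; _∷_)
import Data.List.Relation.Unary.Unique.Propositional.Properties as Unique
open import Induction.WellFounded using (Acc; acc)
open import Relation.Nullary using (¬_; Dec; yes; no; does; ¬?)
open import Relation.Nullary.Decidable using (dec-true; dec-false; does-⇔; map′; _×-dec_; _⊎-dec_)
open import Relation.Unary using (Pred; Decidable)
open import Relation.Binary.Definitions using (DecidableEquality)
open import Relation.Binary.PropositionalEquality
open import Function.Bundles using (mk⇔)
open import Algebra.Bundles using (CommutativeRing)
open import Algebra.Structures using (IsCommutativeRing)

[_]*_ : Bool → ℕ → ℕ
[ b ]* n = if b then n else 0

xor-cancelˡ : ∀ s t → s xor (s xor t) ≡ t
xor-cancelˡ false t = refl
xor-cancelˡ true  t = not-involutive t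

xor-not : ∀ s t → s xor (not s xor t) ≡ not t
xor-not false t = refl
xor-not true  t = refl

module Counting {A : Set} (_≟_ : DecidableEquality A) where
  open import Data.Nat using (_+_; _*_)
  open ≡-Reasoning

  total : (A → ℕ) → List A → ℕ
  total f []      = 0
  total f (x ∷ L) = f x + total f L

  count : (A → Bool) → List A → ℕ
  count p = total (λ x → [ p x ]* 1)

  total-cong : ∀ {f g} → (∀ x → f x ≡ g x) → ∀ L → total f L ≡ total g L
  total-cong f≗g []      = refl
  total-cong f≗g (x ∷ L) = cong₂ _+_ (f≗g x) (total-cong f≗g L)

  count-cong : ∀ {p q} → (∀ x → p x ≡ q x) → ∀ L → count p L ≡ count q L
  count-cong p≗q = total-cong (λ x → cong ([_]* 1) (p≗q x))

  total-zero : ∀ L → total (λ _ → 0) L ≡ 0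
  total-zero []      = refl
  total-zero (x ∷ L) = total-zero L

  total-+ : (f g : A → ℕ) (L : List A) → total (λ x → f x + g x) L ≡ total f L + total g L
  total-+ f g []      = refl
  total-+ f g (x ∷ L) = trans (cong (f x + g x +_) (total-+ f g L))
                              (interchange (f x) (g x) (total f L) (total g L))
    where open import Algebra.Properties.CommutativeSemigroup ℕP.+-commutativeSemigroup using (interchange)

  total-scaled : (p : A → Bool) (n : ℕ) (L : List A) → total (λ x → [ p x ]* n) L ≡ n * count p L
  total-scaled p n []      = sym (ℕP.*-zeroʳ n)
  total-scaled p n (x ∷ L) with p x
  ... | true  = trans (cong (n +_) (total-scaled p n L)) (sym (ℕP.*-suc n (count p L)))
  ... | false = total-scaled p n L

  count-none : ∀ {p L} → All (λ x → p x ≡ false) L → count p L ≡ 0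
  count-none []             = refl
  count-none (px≡false ∷ h) rewrite px≡false = count-none h

  count-split : (p q : A → Bool) (L : List A) →
                count p L ≡ count (λ x → p x ∧ q x) L + count (λ x → p x ∧ not (q x)) L
  count-split p q L = trans (total-cong split L) (total-+ _ _ L)
    where
    split : ∀ x → [ p x ]* 1 ≡ [ p x ∧ q x ]* 1 + [ p x ∧ not (q x) ]* 1
    split x with p x | q x
    ... | true  | true  = refl
    ... | true  | false = refl
    ... | false | _     = refl

  count-constant : (cls p : A → Bool) (t : Bool) → (∀ x → cls x ≡ true → p x ≡ t) →
                   (L : List A) → count (λ x → cls x ∧ p x) L ≡ [ t ]* count cls L
  count-constant cls p t const []      = sym (no-entries t)
    where
    no-entries : ∀ t → [ t ]* 0 ≡ 0
    no-entries true  = refl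
    no-entries false = refl
  count-constant cls p t const (x ∷ L) with cls x in x∈cls
  ... | false = count-constant cls p t const L
  ... | true  = trans (cong₂ _+_ (cong ([_]* 1) (const x x∈cls)) (count-constant cls p t const L))
                      (one-more t (count cls L))
    where
    one-more : ∀ t n → [ t ]* 1 + [ t ]* n ≡ [ t ]* suc n
    one-more true  n = refl
    one-more false n = refl

  length-filter : ∀ {P : Pred A 0ℓ} (P? : Decidable P) L → length (filter P? L) ≡ count (λ x → does (P? x)) L
  length-filter P? []      = refl
  length-filter P? (x ∷ L) with does (P? x)
  ... | true  = cong suc (length-filter P? L)
  ... | false = length-filter P? L

  ≟-sym : ∀ x y → does (x ≟ y) ≡ does (y ≟ x)
  ≟-sym x y = does-⇔ (mk⇔ sym sym) (x ≟ y) (y ≟ x)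

  count-point : (a : A) (p : A → Bool) {L : List A} → Unique L → a ∈ L →
                count (λ x → does (x ≟ a) ∧ p x) L ≡ [ p a ]* 1
  count-point a p {a ∷ L} (a∉L ∷ _) (here refl) = begin
    [ does (a ≟ a) ∧ p a ]* 1 + count (λ x → does (x ≟ a) ∧ p x) L
      ≡⟨ cong₂ (λ t n → [ t ∧ p a ]* 1 + n) (dec-true (a ≟ a) refl) (count-none (All.map others a∉L)) ⟩
    [ p a ]* 1 + 0
      ≡⟨ ℕP.+-identityʳ _ ⟩
    [ p a ]* 1 ∎
    where
    others : ∀ {x} → a ≢ x → (does (x ≟ a) ∧ p x) ≡ false
    others {x} a≢x = cong (_∧ p x) (dec-false (x ≟ a) (≢-sym a≢x))
  count-point a p {x ∷ L} (x∉L ∷ uL) (there a∈L) =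
    trans (cong (λ t → [ t ∧ p x ]* 1 + count (λ x → does (x ≟ a) ∧ p x) L) (dec-false (x ≟ a) (All.lookup x∉L a∈L)))
          (count-point a p uL a∈L)

  module Enumeration (E : List A) (unique : Unique E) (complete : ∀ x → x ∈ E) where

    count-at : (a : A) (p : A → Bool) → count (λ x → does (x ≟ a) ∧ p x) E ≡ [ p a ]* 1
    count-at a p = count-point a p unique (complete a)

    count-pair : ∀ {a b} → a ≢ b → count (λ x → does (x ≟ a) ∨ does (x ≟ b)) E ≡ 2
    count-pair {a} {b} a≢b = begin
      count (λ x → does (x ≟ a) ∨ does (x ≟ b)) E
        ≡⟨ count-split _ (λ x → does (x ≟ a)) E ⟩
      count (λ x → (does (x ≟ a) ∨ does (x ≟ b)) ∧ does (x ≟ a)) E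
        + count (λ x → (does (x ≟ a) ∨ does (x ≟ b)) ∧ not (does (x ≟ a))) E
        ≡⟨ cong₂ _+_ (trans (count-cong at-a E) (count-at a (λ _ → true)))
                     (trans (count-cong at-b E) (count-at b (λ x → not (does (x ≟ a))))) ⟩
      1 + [ not (does (b ≟ a)) ]* 1
        ≡⟨ cong (λ t → 1 + [ not t ]* 1) (dec-false (b ≟ a) (≢-sym a≢b)) ⟩
      2 ∎
      where
      at-a : ∀ x → ((does (x ≟ a) ∨ does (x ≟ b)) ∧ does (x ≟ a)) ≡ (does (x ≟ a) ∧ true)
      at-a x with does (x ≟ a)
      ... | true  = refl
      ... | false = ∧-zeroʳ _
      at-b : ∀ x → ((does (x ≟ a) ∨ does (x ≟ b)) ∧ not (does (x ≟ a))) ≡ (does (x ≟ b) ∧ not (does (x ≟ a)))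
      at-b x with does (x ≟ a)
      ... | true  = sym (∧-zeroʳ _)
      ... | false = refl

    fiber-sum : (g : A → A) (p : A → Bool) (L : List A) →
                total (λ b → count (λ y → does (g y ≟ b) ∧ p y) L) E ≡ count p L
    fiber-sum g p []      = total-zero E
    fiber-sum g p (y ∷ L) = begin
      total (λ b → [ does (g y ≟ b) ∧ p y ]* 1 + count (λ y → does (g y ≟ b) ∧ p y) L) E
        ≡⟨ total-+ _ _ E ⟩
      count (λ b → does (g y ≟ b) ∧ p y) E + total (λ b → count (λ y → does (g y ≟ b) ∧ p y) L) E
        ≡⟨ cong₂ _+_ (trans (count-cong (λ b → cong (_∧ p y) (≟-sym (g y) b)) E) (count-at (g y) (λ _ → p y)))
                     (fiber-sum g p L) ⟩
      [ p y ]* 1 + count p L ∎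

module Arithmetic where
  open import Data.Nat using (_+_; _*_)
  open import Data.Nat.DivMod using (m≡m%n+[m/n]*n; m*n/n≡m)
  open ≡-Reasoning

  odd-order : ∀ q → q % 2 ≡ 1 → q ≡ suc (2 * ((q ∸ 1) / 2)) × suc q / 2 ≡ suc ((q ∸ 1) / 2)
  odd-order q odd = trans q≡1+H*2 (cong suc (ℕP.*-comm H 2)) ,
                    trans (cong (λ n → suc n / 2) q≡1+H*2) (m*n/n≡m (suc H) 2)
    where
    H K : ℕ
    H = (q ∸ 1) / 2
    K = q / 2
    q≡1+K*2 : q ≡ suc (K * 2)
    q≡1+K*2 = trans (m≡m%n+[m/n]*n q 2) (cong (_+ K * 2) odd)
    q≡1+H*2 : q ≡ suc (H * 2)
    q≡1+H*2 = trans q≡1+K*2 (cong (λ n → suc (n * 2)) (sym (trans (cong (λ n → (n ∸ 1) / 2) q≡1+K*2) (m*n/n≡m K 2))))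

  private
    k*4≡[2k]*2 : ∀ k → k * 4 ≡ (2 * k) * 2
    k*4≡[2k]*2 k = trans (sym (ℕP.*-assoc k 2 2)) (cong (_* 2) (ℕP.*-comm k 2))

  mod4≡1⇒even : ∀ q → q % 4 ≡ 1 → (q ∸ 1) / 2 ≡ 2 * (q / 4)
  mod4≡1⇒even q q≡1 = begin
    (q ∸ 1) / 2                ≡⟨ cong (λ n → (n ∸ 1) / 2) (trans (m≡m%n+[m/n]*n q 4) (cong (_+ (q / 4) * 4) q≡1)) ⟩
    ((q / 4) * 4) / 2          ≡⟨ cong (_/ 2) (k*4≡[2k]*2 (q / 4)) ⟩
    ((2 * (q / 4)) * 2) / 2    ≡⟨ m*n/n≡m (2 * (q / 4)) 2 ⟩
    2 * (q / 4)                ∎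

  mod4≡3⇒odd : ∀ q → q % 4 ≡ 3 → (q ∸ 1) / 2 ≡ suc (2 * (q / 4))
  mod4≡3⇒odd q q≡3 = begin
    (q ∸ 1) / 2                     ≡⟨ cong (λ n → (n ∸ 1) / 2) (trans (m≡m%n+[m/n]*n q 4) (cong (_+ (q / 4) * 4) q≡3)) ⟩
    (2 + (q / 4) * 4) / 2           ≡⟨ cong (λ n → (2 + n) / 2) (k*4≡[2k]*2 (q / 4)) ⟩
    (suc (2 * (q / 4)) * 2) / 2     ≡⟨ m*n/n≡m (suc (2 * (q / 4))) 2 ⟩
    suc (2 * (q / 4))               ∎

  -- spread H a b c j is the number of values of multiplicity j of a map on F
  -- whose value 0 has multiplicity a, and whose H nonzero squares (resp. H
  -- nonsquares) all have multiplicity b (resp. c).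
  spread : ℕ → ℕ → ℕ → ℕ → ℕ → ℕ
  spread H a b c j = [ does (a ℕ.≟ j) ]* 1 + ([ does (b ℕ.≟ j) ]* H + [ does (c ℕ.≟ j) ]* H)

  spread-swap : ∀ H a b c j → spread H a b c j ≡ spread H a c b j
  spread-swap H a b c j = cong ([ does (a ℕ.≟ j) ]* 1 +_) (ℕP.+-comm ([ does (b ℕ.≟ j) ]* H) ([ does (c ℕ.≟ j) ]* H))

  private
    absent : ∀ {a j} n → a ≢ j → [ does (a ℕ.≟ j) ]* n ≡ 0
    absent {a} {j} n a≢j = cong ([_]* n) (dec-false (a ℕ.≟ j) a≢j)

  OneToOne : (ℕ → ℕ) → ℕ → Set
  OneToOne N q = N 1 ≡ q × (∀ j → j ≢ 1 → N j ≡ 0)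

  TwoToOne : (ℕ → ℕ) → ℕ → Set
  TwoToOne N H = N 0 ≡ H × N 1 ≡ 1 × N 2 ≡ H × (∀ j → j ≢ 0 → j ≢ 1 → j ≢ 2 → N j ≡ 0)

  Collapsing : (ℕ → ℕ) → ℕ → ℕ → Set
  Collapsing N H t = N 0 ≡ H × N 1 ≡ H × N t ≡ 1 × (∀ j → j ≢ 0 → j ≢ 1 → j ≢ t → N j ≡ 0)

  one-to-one : ∀ {N H} → (∀ j → N j ≡ spread H 1 1 1 j) → OneToOne N (suc (2 * H))
  one-to-one {N} {H} N≗ = trans (N≗ 1) (cong (λ n → suc (H + n)) (sym (ℕP.+-identityʳ H))) ,
    λ j j≢1 → trans (N≗ j) (cong₂ _+_ (absent 1 (≢-sym j≢1)) (cong₂ _+_ (absent H (≢-sym j≢1)) (absent H (≢-sym j≢1))))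

  two-to-one : ∀ {N H} → (∀ j → N j ≡ spread H 1 2 0 j) → TwoToOne N H
  two-to-one {N} {H} N≗ = N≗ 0 , N≗ 1 , trans (N≗ 2) (ℕP.+-identityʳ H) ,
    λ j j≢0 j≢1 j≢2 → trans (N≗ j) (cong₂ _+_ (absent 1 (≢-sym j≢1))
                                    (cong₂ _+_ (absent H (≢-sym j≢2)) (absent H (≢-sym j≢0))))

  collapsing : ∀ {N H} → H ≢ 0 → (∀ j → N j ≡ spread H (suc H) 0 1 j) → Collapsing N H (suc H)
  collapsing {N} {H} H≢0 N≗ =
    trans (N≗ 0) (ℕP.+-identityʳ H) ,
    trans (N≗ 1) (cong (_+ H) (absent 1 1+H≢1)) ,
    trans (N≗ (suc H)) (cong₂ _+_ (cong ([_]* 1) (dec-true (suc H ℕ.≟ suc H) refl))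
                                 (cong₂ _+_ (absent {0} {suc H} H (λ ())) (absent H (≢-sym 1+H≢1)))) ,
    λ j j≢0 j≢1 j≢1+H → trans (N≗ j) (cong₂ _+_ (absent 1 (≢-sym j≢1+H))
                                     (cong₂ _+_ (absent H (≢-sym j≢0)) (absent H (≢-sym j≢1))))
    where
    1+H≢1 : suc H ≢ 1
    1+H≢1 1+H≡1 = H≢0 (ℕP.suc-injective 1+H≡1)

module FieldTheory (F : FiniteField) where
  open FiniteField F
  open Arithmetic using (spread; spread-swap; OneToOne; TwoToOne; Collapsing; one-to-one; two-to-one; collapsing)
  open IsCommutativeRing isCommutativeRing
    using (+-assoc; +-identityˡ; +-identityʳ; -‿inverseˡ; -‿inverseʳ;
           *-assoc; *-comm; *-identityˡ; *-identityʳ; distribʳ; zeroˡ; zeroʳ)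
  open ≡-Reasoning

  commutativeRing : CommutativeRing 0ℓ 0ℓ
  commutativeRing = record
    { Carrier = Carrier; _≈_ = _≡_; _+_ = _+_; _*_ = _*_; -_ = -_; 0# = 0#; 1# = 1#
    ; isCommutativeRing = isCommutativeRing }

  open CommutativeRing commutativeRing using (ring; commutativeSemiring; *-commutativeSemigroup)
  open import Algebra.Properties.Ring ring public
    using (-‿involutive; -‿injective; -0#≈0#; -‿distribˡ-*; -‿distribʳ-*; -1*x≈-x; -‿+-comm;
           +-cancelˡ; +-inverseʳ-unique; x∙y⁻¹≈ε⇒x≈y; x[y-z]≈xy-xz; [y-z]x≈yx-zx)
  open import Algebra.Properties.CommutativeSemiring.Exp commutativeSemiring using (_^_; ^-homo-*; ^-distrib-*)
  open import Algebra.Properties.CommutativeSemigroup *-commutativeSemigroup using (x∙yz≈y∙xz)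

  pow≡^ : ∀ x n → pow x n ≡ x ^ n
  pow≡^ x zero    = refl
  pow≡^ x (suc n) = cong (x *_) (pow≡^ x n)

  pow-+ : ∀ x m n → pow x (m ℕ.+ n) ≡ pow x m * pow x n
  pow-+ x m n = begin
    pow x (m ℕ.+ n)      ≡⟨ pow≡^ x (m ℕ.+ n) ⟩
    x ^ (m ℕ.+ n)        ≡⟨ ^-homo-* x m n ⟩
    x ^ m * x ^ n        ≡⟨ sym (cong₂ _*_ (pow≡^ x m) (pow≡^ x n)) ⟩
    pow x m * pow x n    ∎

  pow-* : ∀ x y n → pow (x * y) n ≡ pow x n * pow y n
  pow-* x y n = begin
    pow (x * y) n        ≡⟨ pow≡^ (x * y) n ⟩
    (x * y) ^ n          ≡⟨ ^-distrib-* x y n ⟩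
    x ^ n * y ^ n        ≡⟨ sym (cong₂ _*_ (pow≡^ x n) (pow≡^ y n)) ⟩
    pow x n * pow y n    ∎

  pow-1# : ∀ n → pow 1# n ≡ 1#
  pow-1# zero    = refl
  pow-1# (suc n) = trans (*-identityˡ _) (pow-1# n)

  neg-square : ∀ x → - x * - x ≡ x * x
  neg-square x = trans (sym (-‿distribˡ-* x (- x))) (trans (cong -_ (sym (-‿distribʳ-* x x))) (-‿involutive (x * x)))

  -- The multiplicative inverse (with inv 0 = 0).
  inv : Carrier → Carrier
  inv x with x ≟ 0#
  ... | yes _   = 0#
  ... | no x≢0  = proj₁ (inverse x x≢0)

  inverseʳ : ∀ {x} → x ≢ 0# → x * inv x ≡ 1#
  inverseʳ {x} x≢0 with x ≟ 0#
  ... | yes x≡0 = ⊥-elim (x≢0 x≡0)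
  ... | no x≢0′ = proj₂ (inverse x x≢0′)

  inv-cancelˡ : ∀ {x} a → x ≢ 0# → inv x * (x * a) ≡ a
  inv-cancelˡ {x} a x≢0 = begin
    inv x * (x * a)    ≡⟨ sym (*-assoc (inv x) x a) ⟩
    (inv x * x) * a    ≡⟨ cong (_* a) (trans (*-comm (inv x) x) (inverseʳ x≢0)) ⟩
    1# * a             ≡⟨ *-identityˡ a ⟩
    a                  ∎

  inv-cancelʳ : ∀ {x} a → x ≢ 0# → x * (inv x * a) ≡ a
  inv-cancelʳ {x} a x≢0 = trans (sym (*-assoc x (inv x) a)) (trans (cong (_* a) (inverseʳ x≢0)) (*-identityˡ a))

  *-cancelˡ : ∀ {x a b} → x ≢ 0# → x * a ≡ x * b → a ≡ b
  *-cancelˡ {x} {a} {b} x≢0 xa≡xb =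
    trans (sym (inv-cancelˡ a x≢0)) (trans (cong (inv x *_) xa≡xb) (inv-cancelˡ b x≢0))

  linear-solution : ∀ {u x b} → u ≢ 0# → u * x ≡ b → x ≡ inv u * b
  linear-solution {u} {x} u≢0 ux≡b = trans (sym (inv-cancelˡ x u≢0)) (cong (inv u *_) ux≡b)

  zero-product : ∀ {x y} → x * y ≡ 0# → x ≡ 0# ⊎ y ≡ 0#
  zero-product {x} {y} xy≡0 with x ≟ 0#
  ... | yes x≡0 = inj₁ x≡0
  ... | no x≢0  = inj₂ (*-cancelˡ x≢0 (trans xy≡0 (sym (zeroʳ x))))

  *-nonzero : ∀ {x y} → x ≢ 0# → y ≢ 0# → x * y ≢ 0#
  *-nonzero x≢0 y≢0 xy≡0 with zero-product xy≡0
  ... | inj₁ x≡0 = x≢0 x≡0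
  ... | inj₂ y≡0 = y≢0 y≡0

  -‿nonzero : ∀ {x} → x ≢ 0# → - x ≢ 0#
  -‿nonzero x≢0 -x≡0 = x≢0 (-‿injective (trans -x≡0 (sym -0#≈0#)))

  quotient-nonzero : ∀ {w b} → w ≢ 0# → b ≢ 0# → inv w * b ≢ 0#
  quotient-nonzero {w} {b} w≢0 b≢0 w⁻¹b≡0 = b≢0 (trans (sym (inv-cancelʳ b w≢0)) (trans (cong (w *_) w⁻¹b≡0) (zeroʳ w)))

  difference-of-squares : ∀ x y → (x + y) * (x - y) ≡ x * x - y * y
  difference-of-squares x y = begin
    (x + y) * (x - y)                      ≡⟨ distribʳ (x - y) x y ⟩
    x * (x - y) + y * (x - y)              ≡⟨ cong₂ _+_ (x[y-z]≈xy-xz x x y) (x[y-z]≈xy-xz y x y) ⟩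
    (x * x - x * y) + (y * x - y * y)      ≡⟨ cong (λ t → (x * x - x * y) + (t - y * y)) (*-comm y x) ⟩
    (x * x - x * y) + (x * y - y * y)      ≡⟨ +-assoc (x * x) (- (x * y)) _ ⟩
    x * x + (- (x * y) + (x * y - y * y))  ≡⟨ cong (x * x +_) (sym (+-assoc (- (x * y)) (x * y) _)) ⟩
    x * x + ((- (x * y) + x * y) - y * y)  ≡⟨ cong (λ t → x * x + (t - y * y)) (-‿inverseˡ (x * y)) ⟩
    x * x + (0# - y * y)                   ≡⟨ cong (x * x +_) (+-identityˡ _) ⟩
    x * x - y * y                          ∎

  square-roots : ∀ {x y} → x * x ≡ y * y → x ≡ y ⊎ x ≡ - y
  square-roots {x} {y} xx≡yy
    with zero-product (trans (difference-of-squares x y) (trans (cong (_- y * y) xx≡yy) (-‿inverseʳ (y * y))))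
  ... | inj₁ x+y≡0 = inj₂ (trans (sym (-‿involutive x)) (cong -_ (sym (+-inverseʳ-unique x y x+y≡0))))
  ... | inj₂ x-y≡0 = inj₁ (x∙y⁻¹≈ε⇒x≈y x y x-y≡0)

  product : List Carrier → Carrier
  product []      = 1#
  product (x ∷ L) = x * product L

  _∖_ : List Carrier → Carrier → List Carrier
  L ∖ y = filter (λ x → ¬? (x ≟ y)) L

  ∈-∖⁺ : ∀ {x y L} → x ∈ L → x ≢ y → x ∈ L ∖ y
  ∈-∖⁺ {y = y} = ∈-filter⁺ (λ x → ¬? (x ≟ y))

  ∈-∖⁻ : ∀ {x y} L → x ∈ L ∖ y → x ∈ L × x ≢ y
  ∈-∖⁻ {y = y} L = ∈-filter⁻ (λ x → ¬? (x ≟ y)) {xs = L}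

  ∖-unique : ∀ {y L} → Unique L → Unique (L ∖ y)
  ∖-unique {y} = Unique.filter⁺ (λ x → ¬? (x ≟ y))

  private
    ∖-head : ∀ {y L} → Unique (y ∷ L) → (y ∷ L) ∖ y ≡ L
    ∖-head {y} u = trans (filter-reject (λ x → ¬? (x ≟ y)) (λ y≢y → y≢y refl))
                         (filter-all (λ x → ¬? (x ≟ y)) (All.map ≢-sym (AllPairs.head u)))

    ∖-cons : ∀ {x y L} → x ≢ y → (x ∷ L) ∖ y ≡ x ∷ (L ∖ y)
    ∖-cons {y = y} = filter-accept (λ x → ¬? (x ≟ y))

  length-∖ : ∀ {y L} → Unique L → y ∈ L → length L ≡ suc (length (L ∖ y))
  length-∖ u (here refl) = cong (suc ∘ length) (sym (∖-head u))
  length-∖ {y} {x ∷ L} (x∉L ∷ uL) (there y∈L) =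
    cong suc (trans (length-∖ uL y∈L) (cong length (sym (∖-cons (All.lookup x∉L y∈L)))))

  product-∖ : ∀ {y L} → Unique L → y ∈ L → product L ≡ y * product (L ∖ y)
  product-∖ {y} u (here refl) = cong (λ L → y * product L) (sym (∖-head u))
  product-∖ {y} {x ∷ L} (x∉L ∷ uL) (there y∈L) = begin
    x * product L                   ≡⟨ cong (x *_) (product-∖ uL y∈L) ⟩
    x * (y * product (L ∖ y))       ≡⟨ x∙yz≈y∙xz x y _ ⟩
    y * (x * product (L ∖ y))       ≡⟨ cong (λ L → y * product L) (sym (∖-cons (All.lookup x∉L y∈L))) ⟩
    y * product ((x ∷ L) ∖ y)       ∎

  record PairedBy (σ : Carrier → Carrier) (L : List Carrier) : Set where
    field
      distinct      : Unique L
      closed        : ∀ {x} → x ∈ L → σ x ∈ L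
      involutive    : ∀ {x} → x ∈ L → σ (σ x) ≡ x
      fixpoint-free : ∀ {x} → x ∈ L → σ x ≢ x

  remove-pair : ∀ {σ x L} → PairedBy σ (x ∷ L) → σ x ∈ L × PairedBy σ (L ∖ σ x)
  remove-pair {σ} {x} {L} P = σx∈L , record
    { distinct      = ∖-unique (AllPairs.tail distinct)
    ; closed        = closed′
    ; involutive    = λ z∈ → involutive (there (proj₁ (∈-∖⁻ L z∈)))
    ; fixpoint-free = λ z∈ → fixpoint-free (there (proj₁ (∈-∖⁻ L z∈)))
    }
    where
    open PairedBy P
    σx∈L : σ x ∈ L
    σx∈L with closed (here refl)
    ... | here σx≡x  = ⊥-elim (fixpoint-free (here refl) σx≡x)
    ... | there σx∈L = σx∈L
    closed′ : ∀ {z} → z ∈ L ∖ σ x → σ z ∈ L ∖ σ x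
    closed′ {z} z∈ with ∈-∖⁻ L z∈
    ... | z∈L , z≢σx with closed (there z∈L)
    ...   | here σz≡x  = ⊥-elim (z≢σx (trans (sym (involutive (there z∈L))) (cong σ σz≡x)))
    ...   | there σz∈L = ∈-∖⁺ σz∈L σz≢σx
      where
      -- σ is injective on L, and x ∉ L
      σz≢σx : σ z ≢ σ x
      σz≢σx σz≡σx = All.lookup (AllPairs.head distinct) z∈L
        (sym (trans (sym (involutive (there z∈L))) (trans (cong σ σz≡σx) (involutive (here refl)))))

  Pairing : (Carrier → Carrier) → Carrier → List Carrier → Set
  Pairing σ a L = Σ ℕ λ k → length L ≡ 2 ℕ.* k × ((∀ {x} → x ∈ L → x * σ x ≡ a) → product L ≡ pow a k)

  pairing : ∀ σ a L → PairedBy σ L → Pairing σ a L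
  pairing σ a L P = go L P (<-wellFounded (length L))
    where
    go : ∀ L → PairedBy σ L → Acc ℕ._<_ (length L) → Pairing σ a L
    go []      P _        = 0 , refl , λ _ → refl
    go (x ∷ L) P (acc rs) = suc k , length-eq , product-eq
      where
      σx∈L : σ x ∈ L
      σx∈L = proj₁ (remove-pair P)
      uL : Unique L
      uL = AllPairs.tail (PairedBy.distinct P)
      L′ : List Carrier
      L′ = L ∖ σ x
      L≡ : length L ≡ suc (length L′)
      L≡ = length-∖ uL σx∈L
      rec : Pairing σ a L′
      rec = go L′ (proj₂ (remove-pair P)) (rs (ℕ.s≤s (subst (length L′ ℕ.≤_) (sym L≡) (ℕP.n≤1+n _))))
      k : ℕ
      k = proj₁ rec
      length-eq : suc (length L) ≡ 2 ℕ.* suc k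
      length-eq = trans (cong suc (trans L≡ (cong suc (proj₁ (proj₂ rec))))) (sym (ℕP.*-suc 2 k))
      product-eq : (∀ {z} → z ∈ x ∷ L → z * σ z ≡ a) → product (x ∷ L) ≡ pow a (suc k)
      product-eq pairs = begin
        x * product L              ≡⟨ cong (x *_) (product-∖ uL σx∈L) ⟩
        x * (σ x * product L′)     ≡⟨ sym (*-assoc x (σ x) _) ⟩
        (x * σ x) * product L′     ≡⟨ cong₂ _*_ (pairs (here refl))
                                       (proj₂ (proj₂ rec) (λ z∈ → pairs (there (proj₁ (∈-∖⁻ L z∈))))) ⟩
        a * pow a k                ∎

  paired-product : ∀ {σ a L} k → PairedBy σ L → length L ≡ 2 ℕ.* k →
                   (∀ {x} → x ∈ L → x * σ x ≡ a) → product L ≡ pow a k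
  paired-product {σ} {a} {L} k P length≡ pairs with pairing σ a L P
  ... | k′ , length≡′ , product≡ =
    trans (product≡ pairs) (cong (pow a) (ℕP.*-cancelˡ-≡ k′ k 2 (trans (sym length≡′) length≡)))

  translation-pairs : 1# + 1# ≡ 0# → PairedBy (_+ 1#) elements
  translation-pairs 2≡0 = record
    { distinct      = unique
    ; closed        = λ {x} _ → complete (x + 1#)
    ; involutive    = λ {x} _ → trans (+-assoc x 1# 1#) (trans (cong (x +_) 2≡0) (+-identityʳ x))
    ; fixpoint-free = λ {x} _ x+1≡x → 0≢1 (sym (+-cancelˡ x 1# 0# (trans x+1≡x (sym (+-identityʳ x)))))
    }

  module OddOrder (H : ℕ) (size≡ : size ≡ suc (2 ℕ.* H)) where
    open Counting _≟_
    open Enumeration elements unique complete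

    -- 1 + 1 ≠ 0, since otherwise the q elements of F would come in pairs.
    two≢0 : 1# + 1# ≢ 0#
    two≢0 2≡0 with pairing (_+ 1#) 0# elements (translation-pairs 2≡0)
    ... | k , length≡ , _ = ℕP.even≢odd k H (trans (sym length≡) size≡)

    x≢-x : ∀ {x} → x ≢ 0# → x ≢ - x
    x≢-x {x} x≢0 x≡-x = *-nonzero two≢0 x≢0 (begin
      (1# + 1#) * x     ≡⟨ distribʳ x 1# 1# ⟩
      1# * x + 1# * x   ≡⟨ cong₂ _+_ (*-identityˡ x) (trans (*-identityˡ x) x≡-x) ⟩
      x + - x           ≡⟨ -‿inverseʳ x ⟩
      0#                ∎)

    1≢-1 : 1# ≢ - 1#
    1≢-1 = x≢-x (≢-sym 0≢1)

    units : List Carrier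
    units = elements ∖ 0#

    ∈-units : ∀ {x} → x ≢ 0# → x ∈ units
    ∈-units {x} = ∈-∖⁺ (complete x)

    units-nonzero : ∀ {x} → x ∈ units → x ≢ 0#
    units-nonzero x∈ = proj₂ (∈-∖⁻ elements x∈)

    units-unique : Unique units
    units-unique = ∖-unique unique

    length-units : length units ≡ 2 ℕ.* H
    length-units = ℕP.suc-injective (trans (sym (length-∖ unique (complete 0#))) size≡)

    H≢0 : H ≢ 0
    H≢0 H≡0 = ℕP.1+n≢0 (trans (sym (length-∖ units-unique (∈-units (≢-sym 0≢1))))
                               (trans length-units (cong (2 ℕ.*_) H≡0)))

    module Reciprocal (a : Carrier) (a≢0 : a ≢ 0#) where

      σ : Carrier → Carrier
      σ x = a * inv x

      pair-product : ∀ {x} → x ≢ 0# → x * σ x ≡ a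
      pair-product {x} x≢0 = trans (x∙yz≈y∙xz x a (inv x)) (trans (cong (a *_) (inverseʳ x≢0)) (*-identityʳ a))

      σ-nonzero : ∀ {x} → x ≢ 0# → σ x ≢ 0#
      σ-nonzero {x} x≢0 σx≡0 = a≢0 (trans (sym (pair-product x≢0)) (trans (cong (x *_) σx≡0) (zeroʳ x)))

      σ-involutive : ∀ {x} → x ≢ 0# → σ (σ x) ≡ x
      σ-involutive {x} x≢0 = *-cancelˡ (σ-nonzero x≢0)
        (trans (pair-product (σ-nonzero x≢0)) (trans (sym (pair-product x≢0)) (*-comm x (σ x))))

      σ-fixed : ∀ {x} → x ≢ 0# → σ x ≡ x → x * x ≡ a
      σ-fixed {x} x≢0 σx≡x = trans (cong (x *_) (sym σx≡x)) (pair-product x≢0)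

    -- χ(x) = x^H; Euler's criterion below identifies it with the Legendre symbol.
    χ : Carrier → Carrier
    χ x = pow x H

    -- For a nonsquare a, x ↦ a/x pairs up all units, so their product is a^H.
    product-units-nonsquare : ∀ {a} → a ≢ 0# → ¬ IsSquare a → product units ≡ χ a
    product-units-nonsquare {a} a≢0 nonsquare =
      paired-product H paired length-units (λ x∈ → pair-product (units-nonzero x∈))
      where
      open Reciprocal a a≢0
      paired : PairedBy σ units
      paired = record
        { distinct      = units-unique
        ; closed        = λ x∈ → ∈-units (σ-nonzero (units-nonzero x∈))
        ; involutive    = λ x∈ → σ-involutive (units-nonzero x∈)
        ; fixpoint-free = λ {x} x∈ σx≡x → nonsquare (x , σ-fixed (units-nonzero x∈) σx≡x)
        }

    -- For a = b², x ↦ a/x fixes exactly ±b and pairs up the other units, so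
    -- the product of all units is b (-b) a^(H-1) = -a^H.
    module SquareProduct (b : Carrier) (b≢0 : b ≢ 0#) where
      a : Carrier
      a = b * b

      open Reciprocal a (*-nonzero b≢0 b≢0)

      -b≢0 : - b ≢ 0#
      -b≢0 = -‿nonzero b≢0

      -b∈ : - b ∈ units ∖ b
      -b∈ = ∈-∖⁺ (∈-units -b≢0) (≢-sym (x≢-x b≢0))

      others : List Carrier
      others = (units ∖ b) ∖ (- b)

      ∈-others : ∀ {z} → z ≢ 0# → z ≢ b → z ≢ - b → z ∈ others
      ∈-others z≢0 z≢b z≢-b = ∈-∖⁺ (∈-∖⁺ (∈-units z≢0) z≢b) z≢-b

      others-spec : ∀ {z} → z ∈ others → z ≢ 0# × z ≢ b × z ≢ - b
      others-spec z∈ with ∈-∖⁻ (units ∖ b) z∈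
      ... | z∈′ , z≢-b with ∈-∖⁻ units z∈′
      ...   | z∈″ , z≢b = units-nonzero z∈″ , z≢b , z≢-b

      σ-avoids-roots : ∀ {z c} → z ≢ 0# → c ≢ 0# → c * c ≡ a → σ z ≡ c → z ≡ c
      σ-avoids-roots {z} {c} z≢0 c≢0 cc≡a σz≡c =
        trans (sym (σ-involutive z≢0)) (trans (cong σ σz≡c) (*-cancelˡ c≢0 (trans (pair-product c≢0) (sym cc≡a))))

      paired : PairedBy σ others
      paired = record
        { distinct      = ∖-unique (∖-unique units-unique)
        ; closed        = closed
        ; involutive    = λ z∈ → σ-involutive (proj₁ (others-spec z∈))
        ; fixpoint-free = fixpoint-free
        }
        where
        closed : ∀ {z} → z ∈ others → σ z ∈ others
        closed z∈ with others-spec z∈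
        ... | z≢0 , z≢b , z≢-b = ∈-others (σ-nonzero z≢0)
          (λ σz≡b → z≢b (σ-avoids-roots z≢0 b≢0 refl σz≡b))
          (λ σz≡-b → z≢-b (σ-avoids-roots z≢0 -b≢0 (neg-square b) σz≡-b))
        fixpoint-free : ∀ {z} → z ∈ others → σ z ≢ z
        fixpoint-free z∈ σz≡z with others-spec z∈
        ... | z≢0 , z≢b , z≢-b with square-roots (σ-fixed z≢0 σz≡z)
        ...   | inj₁ z≡b  = z≢b z≡b
        ...   | inj₂ z≡-b = z≢-b z≡-b

      k : ℕ
      k = ℕ.pred H

      H≡1+k : H ≡ suc k
      H≡1+k = sym (ℕP.suc-pred H {{ℕ.≢-nonZero H≢0}})

      length-others : length others ≡ 2 ℕ.* k
      length-others = ℕP.suc-injective (ℕP.suc-injective (begin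
        suc (suc (length others))   ≡⟨ cong suc (sym (length-∖ (∖-unique units-unique) -b∈)) ⟩
        suc (length (units ∖ b))    ≡⟨ sym (length-∖ units-unique (∈-units b≢0)) ⟩
        length units                ≡⟨ trans length-units (cong (2 ℕ.*_) H≡1+k) ⟩
        2 ℕ.* suc k                 ≡⟨ ℕP.*-suc 2 k ⟩
        suc (suc (2 ℕ.* k))         ∎))

      product-units : product units ≡ - χ a
      product-units = begin
        product units                ≡⟨ product-∖ units-unique (∈-units b≢0) ⟩
        b * product (units ∖ b)      ≡⟨ cong (b *_) (product-∖ (∖-unique units-unique) -b∈) ⟩
        b * (- b * product others)   ≡⟨ sym (*-assoc b (- b) _) ⟩
        (b * - b) * product others   ≡⟨ cong₂ _*_ (sym (-‿distribʳ-* b b))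
                                          (paired-product k paired length-others
                                            (λ z∈ → pair-product (proj₁ (others-spec z∈)))) ⟩
        - a * pow a k                ≡⟨ sym (-‿distribˡ-* a (pow a k)) ⟩
        - pow a (suc k)              ≡⟨ cong (λ n → - pow a n) (sym H≡1+k) ⟩
        - χ a                        ∎

    wilson : product units ≡ - 1#
    wilson = trans (SquareProduct.product-units 1# (≢-sym 0≢1))
                   (cong -_ (trans (cong (λ x → pow x H) (*-identityˡ 1#)) (pow-1# H)))

    euler-square : ∀ {a} → a ≢ 0# → IsSquare a → χ a ≡ 1#
    euler-square a≢0 (b , bb≡a) =
      -‿injective (trans (sym (subst (λ a → product units ≡ - χ a) bb≡a (SquareProduct.product-units b b≢0))) wilson)
      where
      b≢0 : b ≢ 0#
      b≢0 b≡0 = a≢0 (trans (sym bb≡a) (trans (cong (_* b) b≡0) (zeroˡ b)))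

    euler-nonsquare : ∀ {a} → a ≢ 0# → ¬ IsSquare a → χ a ≡ - 1#
    euler-nonsquare a≢0 nonsquare = trans (sym (product-units-nonsquare a≢0 nonsquare)) wilson

    square? : ∀ x → Dec (IsSquare x)
    square? x = map′ satisfied (λ (y , yy≡x) → lose (complete y) yy≡x) (any? (λ y → (y * y) ≟ x) elements)

    -- The quadratic character as a boolean: nr x holds iff x is a
    -- nonsquare (so nr 0 = false).
    nr : Carrier → Bool
    nr x = not (does (square? x))

    nr-square : ∀ {x} → IsSquare x → nr x ≡ false
    nr-square {x} square = cong not (dec-true (square? x) square)

    nr-nonsquare : ∀ {x} → ¬ IsSquare x → nr x ≡ true
    nr-nonsquare {x} nonsquare = cong not (dec-false (square? x) nonsquare)

    sign : Bool → Carrier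
    sign false = 1#
    sign true  = - 1#

    sign-injective : ∀ {s t} → sign s ≡ sign t → s ≡ t
    sign-injective {false} {false} _    = refl
    sign-injective {false} {true}  1≡-1 = ⊥-elim (1≢-1 1≡-1)
    sign-injective {true}  {false} -1≡1 = ⊥-elim (1≢-1 (sym -1≡1))
    sign-injective {true}  {true}  _    = refl

    sign-xor : ∀ s t → sign s * sign t ≡ sign (s xor t)
    sign-xor false t     = *-identityˡ (sign t)
    sign-xor true  false = *-identityʳ (- 1#)
    sign-xor true  true  = trans (-1*x≈-x (- 1#)) (-‿involutive 1#)

    χ≡sign : ∀ {x} → x ≢ 0# → χ x ≡ sign (nr x)
    χ≡sign {x} x≢0 with square? x
    ... | yes square    = trans (euler-square x≢0 square) (cong sign (sym (nr-square square)))
    ... | no  nonsquare = trans (euler-nonsquare x≢0 nonsquare) (cong sign (sym (nr-nonsquare nonsquare)))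

    nr-* : ∀ {x y} → x ≢ 0# → y ≢ 0# → nr (x * y) ≡ nr x xor nr y
    nr-* {x} {y} x≢0 y≢0 = sign-injective (begin
      sign (nr (x * y))            ≡⟨ sym (χ≡sign (*-nonzero x≢0 y≢0)) ⟩
      χ (x * y)                    ≡⟨ pow-* x y H ⟩
      χ x * χ y                    ≡⟨ cong₂ _*_ (χ≡sign x≢0) (χ≡sign y≢0) ⟩
      sign (nr x) * sign (nr y)    ≡⟨ sign-xor (nr x) (nr y) ⟩
      sign (nr x xor nr y)         ∎)

    HasClass : Bool → Carrier → Set
    HasClass s x = x ≢ 0# × nr x ≡ s

    quotient-class : ∀ {w s b} → w ≢ 0# → HasClass s b → HasClass (nr w xor s) (inv w * b)
    quotient-class {w} {s} {b} w≢0 (b≢0 , refl) = y≢0 , (begin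
      nr y                          ≡⟨ sym (xor-cancelˡ (nr w) (nr y)) ⟩
      nr w xor (nr w xor nr y)      ≡⟨ cong (nr w xor_) (sym (nr-* w≢0 y≢0)) ⟩
      nr w xor nr (w * y)           ≡⟨ cong (λ z → nr w xor nr z) (inv-cancelʳ b w≢0) ⟩
      nr w xor nr b                 ∎)
      where
      y : Carrier
      y = inv w * b
      y≢0 : y ≢ 0#
      y≢0 = quotient-nonzero w≢0 b≢0

    nonzero residue nonresidue : Carrier → Bool
    nonzero x    = not (does (x ≟ 0#))
    residue x    = nonzero x ∧ not (nr x)
    nonresidue x = nonzero x ∧ nr x

    nonzero-spec : ∀ {x} → nonzero x ≡ true → x ≢ 0#
    nonzero-spec {x} nz with x ≟ 0#
    nonzero-spec {x} () | yes _
    ... | no x≢0 = x≢0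

    residue-spec : ∀ {x} → residue x ≡ true → HasClass false x
    residue-spec {x} res with nonzero x in nz | nr x
    residue-spec {x} res | true  | false = nonzero-spec nz , refl
    residue-spec {x} ()  | true  | true
    residue-spec {x} ()  | false | _

    nonresidue-spec : ∀ {x} → nonresidue x ≡ true → HasClass true x
    nonresidue-spec {x} non with nonzero x in nz | nr x
    nonresidue-spec {x} non | true  | true  = nonzero-spec nz , refl
    nonresidue-spec {x} ()  | true  | false
    nonresidue-spec {x} ()  | false | _

    residue-of : ∀ {s x} → HasClass s x → residue x ≡ not s
    residue-of {x = x} (x≢0 , refl) = cong (λ t → not t ∧ not (nr x)) (dec-false (x ≟ 0#) x≢0)

    nonresidue-of : ∀ {s x} → HasClass s x → nonresidue x ≡ s
    nonresidue-of {x = x} (x≢0 , refl) = cong (λ t → not t ∧ nr x) (dec-false (x ≟ 0#) x≢0)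

    zero-unclassified : ∀ t → (nonzero 0# ∧ t) ≡ false
    zero-unclassified t = cong (λ z → not z ∧ t) (dec-true (0# ≟ 0#) refl)

    count-nonzero : count nonzero elements ≡ 2 ℕ.* H
    count-nonzero = trans (sym (length-filter (λ x → ¬? (x ≟ 0#)) elements)) length-units

    square-fiber : Carrier → ℕ
    square-fiber b = count (λ y → does ((y * y) ≟ b) ∧ nonzero y) elements

    no-square-roots : ∀ {b} → (∀ {y} → y ≢ 0# → y * y ≢ b) → square-fiber b ≡ 0
    no-square-roots {b} none = count-none {L = elements} (All.tabulate λ {y} _ →
      dec-false (((y * y) ≟ b) ×-dec ¬? (y ≟ 0#)) (λ (yy≡b , y≢0) → none y≢0 yy≡b))

    square-fiber-size : ∀ b → square-fiber b ≡ [ residue b ]* 2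
    square-fiber-size b with b ≟ 0#
    ... | yes b≡0 = no-square-roots (λ y≢0 yy≡b → *-nonzero y≢0 y≢0 (trans yy≡b b≡0))
    ... | no b≢0 with square? b
    ...   | no nonsquare   = trans (no-square-roots (λ {y} _ yy≡b → nonsquare (y , yy≡b)))
                                   (cong (λ t → [ not t ]* 2) (sym (nr-nonsquare nonsquare)))
    ...   | yes (r , rr≡b) = begin
      square-fiber b                                        ≡⟨ count-cong roots elements ⟩
      count (λ y → does (y ≟ r) ∨ does (y ≟ (- r))) elements ≡⟨ count-pair (x≢-x r≢0) ⟩
      2                                                     ≡⟨ cong (λ t → [ not t ]* 2) (sym (nr-square (r , rr≡b))) ⟩
      [ not (nr b) ]* 2                                     ∎
      where
      r≢0 : r ≢ 0#
      r≢0 r≡0 = b≢0 (trans (sym rr≡b) (trans (cong (_* r) r≡0) (zeroˡ r)))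
      roots : ∀ y → (does ((y * y) ≟ b) ∧ nonzero y) ≡ (does (y ≟ r) ∨ does (y ≟ (- r)))
      roots y = does-⇔ (mk⇔ to from) (((y * y) ≟ b) ×-dec ¬? (y ≟ 0#)) ((y ≟ r) ⊎-dec (y ≟ (- r)))
        where
        to : (y * y ≡ b) × y ≢ 0# → y ≡ r ⊎ y ≡ - r
        to (yy≡b , _) = square-roots (trans yy≡b (sym rr≡b))
        from : y ≡ r ⊎ y ≡ - r → (y * y ≡ b) × y ≢ 0#
        from (inj₁ refl) = rr≡b , r≢0
        from (inj₂ refl) = trans (neg-square r) rr≡b , -‿nonzero r≢0

    -- Double counting the squaring map: there are exactly H nonzero squares,
    -- and hence H nonsquares.
    count-residues : count residue elements ≡ H
    count-residues = ℕP.*-cancelˡ-≡ _ H 2 (begin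
      2 ℕ.* count residue elements              ≡⟨ sym (total-scaled residue 2 elements) ⟩
      total (λ b → [ residue b ]* 2) elements   ≡⟨ sym (total-cong square-fiber-size elements) ⟩
      total square-fiber elements               ≡⟨ fiber-sum (λ y → y * y) nonzero elements ⟩
      count nonzero elements                    ≡⟨ count-nonzero ⟩
      2 ℕ.* H                                   ∎)

    count-nonresidues : count nonresidue elements ≡ H
    count-nonresidues = ℕP.+-cancelʳ-≡ H _ H (begin
      count nonresidue elements ℕ.+ H
        ≡⟨ cong (count nonresidue elements ℕ.+_) (sym count-residues) ⟩
      count nonresidue elements ℕ.+ count residue elements
        ≡⟨ sym (count-split nonzero nr elements) ⟩
      count nonzero elements
        ≡⟨ trans count-nonzero (cong (H ℕ.+_) (ℕP.+-identityʳ H)) ⟩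
      H ℕ.+ H ∎)

    count-by-class : ∀ p → count p elements ≡
      [ p 0# ]* 1 ℕ.+ (count (λ x → residue x ∧ p x) elements ℕ.+ count (λ x → nonresidue x ∧ p x) elements)
    count-by-class p = begin
      count p elements
        ≡⟨ count-split p (λ x → does (x ≟ 0#)) elements ⟩
      count (λ x → p x ∧ does (x ≟ 0#)) elements ℕ.+ count (λ x → p x ∧ nonzero x) elements
        ≡⟨ cong₂ ℕ._+_ (trans (count-cong (λ x → ∧-comm (p x) _) elements) (count-at 0# p))
                       (count-split (λ x → p x ∧ nonzero x) nr elements) ⟩
      [ p 0# ]* 1 ℕ.+ (count (λ x → (p x ∧ nonzero x) ∧ nr x) elements
                        ℕ.+ count (λ x → (p x ∧ nonzero x) ∧ not (nr x)) elements)
        ≡⟨ cong ([ p 0# ]* 1 ℕ.+_) (trans (ℕP.+-comm (count (λ x → (p x ∧ nonzero x) ∧ nr x) elements) _)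
             (cong₂ ℕ._+_ (count-cong (λ x → rotate (p x) (nonzero x) (not (nr x))) elements)
                          (count-cong (λ x → rotate (p x) (nonzero x) (nr x)) elements))) ⟩
      [ p 0# ]* 1 ℕ.+ (count (λ x → residue x ∧ p x) elements ℕ.+ count (λ x → nonresidue x ∧ p x) elements) ∎
      where
      rotate : ∀ a b c → (a ∧ b) ∧ c ≡ (b ∧ c) ∧ a
      rotate true  b c = sym (∧-identityʳ (b ∧ c))
      rotate false b c = sym (∧-zeroʳ (b ∧ c))

    distribution : (φ : Carrier → ℕ) (m : Bool → ℕ) → (∀ {s b} → HasClass s b → φ b ≡ m s) →
                   ∀ j → count (λ b → does (φ b ℕ.≟ j)) elements ≡ spread H (φ 0#) (m false) (m true) j
    distribution φ m φ-class j = trans (count-by-class _)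
      (cong ([ does (φ 0# ℕ.≟ j) ]* 1 ℕ.+_)
        (cong₂ ℕ._+_ (within residue residue-spec count-residues)
                     (within nonresidue nonresidue-spec count-nonresidues)))
      where
      within : ∀ {s} (cls : Carrier → Bool) → (∀ {b} → cls b ≡ true → HasClass s b) → count cls elements ≡ H →
               count (λ b → cls b ∧ does (φ b ℕ.≟ j)) elements ≡ [ does (m s ℕ.≟ j) ]* H
      within {s} cls spec size-H = trans
        (count-constant cls _ _ (λ b b∈cls → cong (λ n → does (n ℕ.≟ j)) (φ-class (spec b∈cls))) elements)
        (cong ([ does (m s ℕ.≟ j) ]*_) size-H)

    linear-solutions : ∀ (cls : Carrier → Bool) {w} → w ≢ 0# → ∀ b →
                       count (λ x → cls x ∧ does ((w * x) ≟ b)) elements ≡ [ cls (inv w * b) ]* 1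
    linear-solutions cls {w} w≢0 b = trans (count-cong solve elements) (count-at (inv w * b) cls)
      where
      solve : ∀ x → (cls x ∧ does ((w * x) ≟ b)) ≡ (does (x ≟ (inv w * b)) ∧ cls x)
      solve x = trans (∧-comm (cls x) _) (cong (_∧ cls x)
        (does-⇔ (mk⇔ (linear-solution w≢0) (λ x≡ → trans (cong (w *_) x≡) (inv-cancelʳ b w≢0)))
                ((w * x) ≟ b) (x ≟ (inv w * b))))

    flat-solutions : ∀ (cls : Carrier → Bool) {w} → w ≡ 0# → ∀ b →
                     count (λ x → cls x ∧ does ((w * x) ≟ b)) elements ≡ [ does (0# ≟ b) ]* count cls elements
    flat-solutions cls w≡0 b =
      count-constant cls _ _ (λ x _ → cong (λ y → does (y ≟ b)) (trans (cong (_* x) w≡0) (zeroˡ x))) elements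

    unclassified-solutions : ∀ (cls : Carrier → Bool) → cls 0# ≡ false → ∀ {w} → w ≢ 0# →
                             count (λ x → cls x ∧ does ((w * x) ≟ 0#)) elements ≡ 0
    unclassified-solutions cls cls0 {w} w≢0 =
      trans (linear-solutions cls w≢0 0#) (cong ([_]* 1) (trans (cong cls (zeroʳ (inv w))) cls0))

    residue-solutions : ∀ {w s b t} → w ≢ 0# → HasClass s b → nr w ≡ t →
                        count (λ x → residue x ∧ does ((w * x) ≟ b)) elements ≡ [ not (t xor s) ]* 1
    residue-solutions {s = s} w≢0 b-class nrw = trans (linear-solutions residue w≢0 _)
      (cong ([_]* 1) (trans (residue-of (quotient-class w≢0 b-class)) (cong (λ r → not (r xor s)) nrw)))

    nonresidue-solutions : ∀ {w s b t} → w ≢ 0# → HasClass s b → nr w ≡ t →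
                           count (λ x → nonresidue x ∧ does ((w * x) ≟ b)) elements ≡ [ t xor s ]* 1
    nonresidue-solutions {s = s} w≢0 b-class nrw = trans (linear-solutions nonresidue w≢0 _)
      (cong ([_]* 1) (trans (nonresidue-of (quotient-class w≢0 b-class)) (cong (_xor s) nrw)))

    flat-solutions-at-0 : ∀ (cls : Carrier → Bool) {w} → w ≡ 0# → count cls elements ≡ H →
                          count (λ x → cls x ∧ does ((w * x) ≟ 0#)) elements ≡ H
    flat-solutions-at-0 cls w≡0 size-H =
      trans (flat-solutions cls w≡0 0#) (cong₂ [_]*_ (dec-true (0# ≟ 0#) refl) size-H)

    flat-solutions-off-0 : ∀ (cls : Carrier → Bool) {w b} → w ≡ 0# → b ≢ 0# →
                           count (λ x → cls x ∧ does ((w * x) ≟ b)) elements ≡ 0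
    flat-solutions-off-0 cls {b = b} w≡0 b≢0 =
      trans (flat-solutions cls w≡0 b) (cong ([_]* count cls elements) (dec-false (0# ≟ b) (≢-sym b≢0)))

    module PiecewiseLinear (g : Carrier → Carrier) (u v : Carrier) (g-zero : g 0# ≡ 0#)
                           (g-residue : ∀ {x} → HasClass false x → g x ≡ u * x)
                           (g-nonresidue : ∀ {x} → HasClass true x → g x ≡ v * x) where

      fiber : Carrier → ℕ
      fiber b = length (filter (λ x → g x ≟ b) elements)

      N : ℕ → ℕ
      N j = length (filter (λ b → fiber b ℕ.≟ j) elements)

      on-residues on-nonresidues : Carrier → ℕ
      on-residues b    = count (λ x → residue x ∧ does ((u * x) ≟ b)) elements
      on-nonresidues b = count (λ x → nonresidue x ∧ does ((v * x) ≟ b)) elements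

      fiber-split : ∀ b → fiber b ≡ [ does (0# ≟ b) ]* 1 ℕ.+ (on-residues b ℕ.+ on-nonresidues b)
      fiber-split b = trans (length-filter (λ x → g x ≟ b) elements) (trans (count-by-class _)
        (cong₂ (λ z n → [ does (z ≟ b) ]* 1 ℕ.+ n) g-zero
          (cong₂ ℕ._+_ (count-cong (on-class residue residue-spec g-residue) elements)
                       (count-cong (on-class nonresidue nonresidue-spec g-nonresidue) elements))))
        where
        on-class : ∀ {s w} (cls : Carrier → Bool) → (∀ {x} → cls x ≡ true → HasClass s x) →
                   (∀ {x} → HasClass s x → g x ≡ w * x) →
                   ∀ x → (cls x ∧ does (g x ≟ b)) ≡ (cls x ∧ does ((w * x) ≟ b))
        on-class cls spec linear x with cls x in x∈cls
        ... | true  = cong (λ y → does (y ≟ b)) (linear (spec x∈cls))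
        ... | false = refl

      fiber-at-0 : fiber 0# ≡ suc (on-residues 0# ℕ.+ on-nonresidues 0#)
      fiber-at-0 = trans (fiber-split 0#) (cong (λ t → [ t ]* 1 ℕ.+ (on-residues 0# ℕ.+ on-nonresidues 0#))
                                                (dec-true (0# ≟ 0#) refl))

      fiber-off-0 : ∀ {b} → b ≢ 0# → fiber b ≡ on-residues b ℕ.+ on-nonresidues b
      fiber-off-0 {b} b≢0 = trans (fiber-split b) (cong (λ t → [ t ]* 1 ℕ.+ (on-residues b ℕ.+ on-nonresidues b))
                                                        (dec-false (0# ≟ b) (≢-sym b≢0)))

      N-from-fibers : ∀ m0 m → fiber 0# ≡ m0 → (∀ {s b} → HasClass s b → fiber b ≡ m s) →
                      ∀ j → N j ≡ spread H m0 (m false) (m true) j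
      N-from-fibers m0 m fiber-0 fiber-class j = begin
        N j                                             ≡⟨ length-filter (λ b → fiber b ℕ.≟ j) elements ⟩
        count (λ b → does (fiber b ℕ.≟ j)) elements     ≡⟨ distribution fiber m fiber-class j ⟩
        spread H (fiber 0#) (m false) (m true) j        ≡⟨ cong (λ n → spread H n (m false) (m true) j) fiber-0 ⟩
        spread H m0 (m false) (m true) j                ∎

      -- For u, v ≠ 0 with characters t, t′: 0 has one preimage, and b ≠ 0 of
      -- character s has [s = t] + [s ≠ t′] preimages.
      slopes-fiber : Bool → Bool → Bool → ℕ
      slopes-fiber t t′ s = [ not (t xor s) ]* 1 ℕ.+ [ t′ xor s ]* 1

      units-profile : u ≢ 0# → v ≢ 0# → ∀ {t t′} → nr u ≡ t → nr v ≡ t′ →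
                      ∀ j → N j ≡ spread H 1 (slopes-fiber t t′ false) (slopes-fiber t t′ true) j
      units-profile u≢0 v≢0 {t} {t′} nru nrv = N-from-fibers 1 (slopes-fiber t t′)
        (trans fiber-at-0 (cong suc (cong₂ ℕ._+_ (unclassified-solutions residue (zero-unclassified _) u≢0)
                                                 (unclassified-solutions nonresidue (zero-unclassified _) v≢0))))
        (λ b-class → trans (fiber-off-0 (proj₁ b-class))
                           (cong₂ ℕ._+_ (residue-solutions u≢0 b-class nru) (nonresidue-solutions v≢0 b-class nrv)))

      -- For u = 0 ≠ v, with v of character t′: the H nonzero squares collapse
      -- onto 0, and b ≠ 0 of character s has [s ≠ t′] preimages.
      residues-collapse : u ≡ 0# → v ≢ 0# → ∀ {t′} → nr v ≡ t′ →
                          ∀ j → N j ≡ spread H (suc H) ([ t′ xor false ]* 1) ([ t′ xor true ]* 1) j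
      residues-collapse u≡0 v≢0 {t′} nrv = N-from-fibers (suc H) (λ s → [ t′ xor s ]* 1)
        (trans fiber-at-0 (cong suc (trans (cong₂ ℕ._+_ (flat-solutions-at-0 residue u≡0 count-residues)
                                                         (unclassified-solutions nonresidue (zero-unclassified _) v≢0))
                                           (ℕP.+-identityʳ H))))
        (λ b-class → trans (fiber-off-0 (proj₁ b-class))
                           (cong₂ ℕ._+_ (flat-solutions-off-0 residue u≡0 (proj₁ b-class)) (nonresidue-solutions v≢0 b-class nrv)))

      -- For v = 0 ≠ u, with u of character t: the H nonsquares collapse onto
      -- 0, and b ≠ 0 of character s has [s = t] preimages.
      nonresidues-collapse : v ≡ 0# → u ≢ 0# → ∀ {t} → nr u ≡ t →
                             ∀ j → N j ≡ spread H (suc H) ([ not (t xor false) ]* 1) ([ not (t xor true) ]* 1) j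
      nonresidues-collapse v≡0 u≢0 {t} nru = N-from-fibers (suc H) (λ s → [ not (t xor s) ]* 1)
        (trans fiber-at-0 (cong suc (cong₂ ℕ._+_ (unclassified-solutions residue (zero-unclassified _) u≢0)
                                                 (flat-solutions-at-0 nonresidue v≡0 count-nonresidues))))
        (λ b-class → trans (fiber-off-0 (proj₁ b-class))
                           (trans (cong₂ ℕ._+_ (residue-solutions u≢0 b-class nru) (flat-solutions-off-0 nonresidue v≡0 (proj₁ b-class)))
                                  (ℕP.+-identityʳ _)))

      bijective : u ≢ 0# → v ≢ 0# → nr u ≡ nr v → OneToOne N (suc (2 ℕ.* H))
      bijective u≢0 v≢0 same with nr u in nru
      ... | false = one-to-one (units-profile u≢0 v≢0 nru (sym same))
      ... | true  = one-to-one (units-profile u≢0 v≢0 nru (sym same))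

      two-to-one-onto-a-class : u ≢ 0# → v ≢ 0# → nr v ≡ not (nr u) → TwoToOne N H
      two-to-one-onto-a-class u≢0 v≢0 opposite with nr u in nru
      ... | false = two-to-one (units-profile u≢0 v≢0 nru opposite)
      ... | true  = two-to-one (λ j → trans (units-profile u≢0 v≢0 nru opposite j) (spread-swap H 1 0 2 j))

      collapsing-a-class : (u ≡ 0# × v ≢ 0#) ⊎ (v ≡ 0# × u ≢ 0#) → Collapsing N H (suc H)
      collapsing-a-class (inj₁ (u≡0 , v≢0)) with nr v in nrv
      ... | false = collapsing H≢0 (residues-collapse u≡0 v≢0 nrv)
      ... | true  = collapsing H≢0 (λ j → trans (residues-collapse u≡0 v≢0 nrv j) (spread-swap H (suc H) 1 0 j))
      collapsing-a-class (inj₂ (v≡0 , u≢0)) with nr u in nru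
      ... | false = collapsing H≢0 (λ j → trans (nonresidues-collapse v≡0 u≢0 nru j) (spread-swap H (suc H) 1 0 j))
      ... | true  = collapsing H≢0 (nonresidues-collapse v≡0 u≢0 nru)

module PowerMap (F : FiniteField) (odd : FiniteField.size F % 2 ≡ 1) where
  open FiniteField F
  open IsCommutativeRing isCommutativeRing using (+-identityʳ; -‿inverseʳ; *-identityˡ; *-identityʳ; distribʳ; zeroˡ; zeroʳ)
  open FieldTheory F
  open Arithmetic using (odd-order; mod4≡1⇒even; mod4≡3⇒odd; OneToOne; TwoToOne; Collapsing)
  open ≡-Reasoning

  H : ℕ
  H = (size ∸ 1) / 2

  size≡ : size ≡ suc (2 ℕ.* H)
  size≡ = proj₁ (odd-order size odd)

  half≡ : suc size / 2 ≡ suc H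
  half≡ = proj₂ (odd-order size odd)

  open OddOrder H size≡

  f : Carrier → Carrier
  f x = pow x (suc size / 2)

  -- f(x) = x χ(x), since (q + 1)/2 = H + 1.
  f≡ : ∀ x → f x ≡ x * χ x
  f≡ x = cong (pow x) half≡

  g : Carrier → Carrier → Carrier
  g c x = f x - c * x

  g-zero : ∀ c → g c 0# ≡ 0#
  g-zero c = trans (cong₂ _-_ (trans (f≡ 0#) (zeroˡ (χ 0#))) (zeroʳ c)) (-‿inverseʳ 0#)

  g-residue : ∀ c {x} → HasClass false x → g c x ≡ (1# - c) * x
  g-residue c {x} (x≢0 , nrx) = begin
    f x - c * x          ≡⟨ cong (_- c * x) (trans (f≡ x) (trans (cong (x *_) (trans (χ≡sign x≢0) (cong sign nrx))) (*-identityʳ x))) ⟩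
    x - c * x            ≡⟨ cong (_- c * x) (sym (*-identityˡ x)) ⟩
    1# * x - c * x       ≡⟨ sym ([y-z]x≈yx-zx x 1# c) ⟩
    (1# - c) * x         ∎

  g-nonresidue : ∀ c {x} → HasClass true x → g c x ≡ (- (1# + c)) * x
  g-nonresidue c {x} (x≢0 , nrx) = begin
    f x - c * x          ≡⟨ cong (_- c * x) (trans (f≡ x) (cong (x *_) (trans (χ≡sign x≢0) (cong sign nrx)))) ⟩
    x * - 1# - c * x     ≡⟨ cong (_- c * x) (trans (sym (-‿distribʳ-* x 1#)) (cong -_ (*-identityʳ x))) ⟩
    - x + - (c * x)      ≡⟨ -‿+-comm x (c * x) ⟩
    - (x + c * x)        ≡⟨ cong (λ y → - (y + c * x)) (sym (*-identityˡ x)) ⟩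
    - (1# * x + c * x)   ≡⟨ cong -_ (sym (distribʳ x 1# c)) ⟩
    - ((1# + c) * x)     ≡⟨ -‿distribˡ-* (1# + c) x ⟩
    (- (1# + c)) * x     ∎

  -- For fixed c, f(x) - c x is piecewise linear; its distribution N is the
  -- function j ↦ M j f c of the theorem.
  module ValuesOf (c : Carrier) = PiecewiseLinear (g c) (1# - c) (- (1# + c)) (g-zero c) (g-residue c) (g-nonresidue c)

  RelativeClass : Bool → Carrier → Set
  RelativeClass d c = Σ Bool λ s → HasClass s (1# - c) × HasClass (d xor s) (1# + c)

  C0-class : ∀ {x} → C0 x → HasClass false x
  C0-class (x≢0 , square) = x≢0 , nr-square square

  C1-class : ∀ {x} → C1 x → HasClass true x
  C1-class (x≢0 , nonsquare) = x≢0 , nr-nonsquare nonsquare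

  one-class : HasClass false 1#
  one-class = ≢-sym 0≢1 , nr-square (1# , *-identityˡ 1#)

  class-00-11 : ∀ {c} → c ≡ 0# ⊎ C00 c ⊎ C11 c → RelativeClass false c
  class-00-11 (inj₁ refl) = false , subst (HasClass false) (sym 1-0≡1) one-class
                                  , subst (HasClass false) (sym (+-identityʳ 1#)) one-class
    where
    1-0≡1 : 1# - 0# ≡ 1#
    1-0≡1 = trans (cong (1# +_) -0#≈0#) (+-identityʳ 1#)
  class-00-11 (inj₂ (inj₁ (_ , u , w))) = false , C0-class u , C0-class w
  class-00-11 (inj₂ (inj₂ (_ , u , w))) = true  , C1-class u , C1-class w

  class-01-10 : ∀ {c} → C01 c ⊎ C10 c → RelativeClass true c
  class-01-10 (inj₁ (_ , u , w)) = false , C0-class u , C1-class w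
  class-01-10 (inj₂ (_ , u , w)) = true  , C1-class u , C0-class w

  negation-class : ∀ {t c} → HasClass t (1# + c) → HasClass (nr (- 1#) xor t) (- (1# + c))
  negation-class {c = c} (w≢0 , refl) = -‿nonzero w≢0 ,
    trans (cong nr (sym (-1*x≈-x (1# + c)))) (nr-* (-‿nonzero (≢-sym 0≢1)) w≢0)

  bijective-case : ∀ {d c} → RelativeClass d c → d ≡ nr (- 1#) → OneToOne (λ j → M j f c) size
  bijective-case {d} {c} (s , (u≢0 , nru) , w-class) d≡ε with negation-class w-class
  ... | v≢0 , nrv = subst (OneToOne (ValuesOf.N c)) (sym size≡) (ValuesOf.bijective c u≢0 v≢0 same)
    where
    same : nr (1# - c) ≡ nr (- (1# + c))
    same = trans nru (sym (trans nrv (trans (cong (λ e → nr (- 1#) xor (e xor s)) d≡ε) (xor-cancelˡ (nr (- 1#)) s))))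

  two-to-one-case : ∀ {d c} → RelativeClass d c → d ≡ not (nr (- 1#)) → TwoToOne (λ j → M j f c) H
  two-to-one-case {d} {c} (s , (u≢0 , nru) , w-class) d≡¬ε with negation-class w-class
  ... | v≢0 , nrv = ValuesOf.two-to-one-onto-a-class c u≢0 v≢0 opposite
    where
    opposite : nr (- (1# + c)) ≡ not (nr (1# - c))
    opposite = trans nrv (trans (cong (λ e → nr (- 1#) xor (e xor s)) d≡¬ε)
                                (trans (xor-not (nr (- 1#)) s) (cong not (sym nru))))

  -- For c = ±1 one of the two slopes vanishes.
  collapsing-case : ∀ {c} → c ≡ 1# ⊎ c ≡ - 1# → Collapsing (λ j → M j f c) H (suc size / 2)
  collapsing-case {c} c≡±1 = subst (Collapsing (ValuesOf.N c) H) (sym half≡)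
                                   (ValuesOf.collapsing-a-class c (slopes c≡±1))
    where
    slopes : ∀ {e} → e ≡ 1# ⊎ e ≡ - 1# → (1# - e ≡ 0# × - (1# + e) ≢ 0#) ⊎ (- (1# + e) ≡ 0# × 1# - e ≢ 0#)
    slopes (inj₁ refl) = inj₁ (-‿inverseʳ 1# , -‿nonzero two≢0)
    slopes (inj₂ refl) = inj₂ (trans (cong -_ (-‿inverseʳ 1#)) -0#≈0# ,
                               λ 1+1≡0 → two≢0 (trans (cong (1# +_) (sym (-‿involutive 1#))) 1+1≡0))

  minus-one-even-power : ∀ m → pow (- 1#) (2 ℕ.* m) ≡ 1#
  minus-one-even-power m = begin
    pow (- 1#) (m ℕ.+ (m ℕ.+ 0))     ≡⟨ cong (λ n → pow (- 1#) (m ℕ.+ n)) (ℕP.+-identityʳ m) ⟩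
    pow (- 1#) (m ℕ.+ m)             ≡⟨ pow-+ (- 1#) m m ⟩
    pow (- 1#) m * pow (- 1#) m      ≡⟨ sym (pow-* (- 1#) (- 1#) m) ⟩
    pow (- 1# * - 1#) m              ≡⟨ cong (λ x → pow x m) (sign-xor true true) ⟩
    pow 1# m                         ≡⟨ pow-1# m ⟩
    1#                               ∎

  -- -1 is a square iff H is even, i.e. iff q ≡ 1 (mod 4).
  minus-one-1-mod-4 : size % 4 ≡ 1 → nr (- 1#) ≡ false
  minus-one-1-mod-4 q≡1 = sign-injective (begin
    sign (nr (- 1#))               ≡⟨ sym (χ≡sign (-‿nonzero (≢-sym 0≢1))) ⟩
    pow (- 1#) H                   ≡⟨ cong (pow (- 1#)) (mod4≡1⇒even size q≡1) ⟩
    pow (- 1#) (2 ℕ.* (size / 4))  ≡⟨ minus-one-even-power (size / 4) ⟩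
    1#                             ∎)

  minus-one-3-mod-4 : size % 4 ≡ 3 → nr (- 1#) ≡ true
  minus-one-3-mod-4 q≡3 = sign-injective (begin
    sign (nr (- 1#))                      ≡⟨ sym (χ≡sign (-‿nonzero (≢-sym 0≢1))) ⟩
    pow (- 1#) H                          ≡⟨ cong (pow (- 1#)) (mod4≡3⇒odd size q≡3) ⟩
    - 1# * pow (- 1#) (2 ℕ.* (size / 4))  ≡⟨ cong (- 1# *_) (minus-one-even-power (size / 4)) ⟩
    - 1# * 1#                             ≡⟨ *-identityʳ (- 1#) ⟩
    - 1#                                  ∎)

propositionB8 : (F : FiniteField) →
    let open FiniteField F
        q = size
        f = λ x → pow x (suc q / 2)
    in IsPrimePower q → q % 2 ≡ 1 →
      (q % 4 ≡ 1 →
        (∀ c → (c ≡ 0# ⊎ C00 c ⊎ C11 c) →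
          M 1 f c ≡ q × (∀ j → j ≢ 1 → M j f c ≡ 0))
        × (∀ c → (C01 c ⊎ C10 c) →
          M 0 f c ≡ (q ∸ 1) / 2 × M 1 f c ≡ 1 × M 2 f c ≡ (q ∸ 1) / 2
            × (∀ j → j ≢ 0 → j ≢ 1 → j ≢ 2 → M j f c ≡ 0))
        × (∀ c → (c ≡ 1# ⊎ c ≡ - 1#) →
          M 0 f c ≡ (q ∸ 1) / 2 × M 1 f c ≡ (q ∸ 1) / 2 × M (suc q / 2) f c ≡ 1
            × (∀ j → j ≢ 0 → j ≢ 1 → j ≢ suc q / 2 → M j f c ≡ 0)))
      × (q % 4 ≡ 3 →
        (∀ c → (C01 c ⊎ C10 c) →
          M 1 f c ≡ q × (∀ j → j ≢ 1 → M j f c ≡ 0))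
        × (∀ c → (c ≡ 0# ⊎ C00 c ⊎ C11 c) →
          M 0 f c ≡ (q ∸ 1) / 2 × M 1 f c ≡ 1 × M 2 f c ≡ (q ∸ 1) / 2
            × (∀ j → j ≢ 0 → j ≢ 1 → j ≢ 2 → M j f c ≡ 0))
        × (∀ c → (c ≡ 1# ⊎ c ≡ - 1#) →
          M 0 f c ≡ (q ∸ 1) / 2 × M 1 f c ≡ (q ∸ 1) / 2 × M (suc q / 2) f c ≡ 1
            × (∀ j → j ≢ 0 → j ≢ 1 → j ≢ suc q / 2 → M j f c ≡ 0)))
propositionB8 F _ odd =
  (λ q≡1 → (λ c c∈ → bijective-case (class-00-11 c∈) (sym (minus-one-1-mod-4 q≡1))) ,
           (λ c c∈ → two-to-one-case (class-01-10 c∈) (sym (cong not (minus-one-1-mod-4 q≡1)))) ,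
           (λ c → collapsing-case)) ,
  (λ q≡3 → (λ c c∈ → bijective-case (class-01-10 c∈) (sym (minus-one-3-mod-4 q≡3))) ,
           (λ c c∈ → two-to-one-case (class-00-11 c∈) (sym (cong not (minus-one-3-mod-4 q≡3)))) ,
           (λ c → collapsing-case))
  where open PowerMap F odd
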